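{- Let $R$ be a Pr\"ufer domain, $M$ an $R$-module and $a,b,c,d\in R$. Then (i) $|a\mid x\,/\,c\mid x\,(M)|=|x=x\,/\,c\mid xa\,(M)|$; (ii) $|a\mid x\,/\,xd=0\,(M)|=|x=x\,/\,xad=0\,(M)|$; (iii) $|xb=0\,/\,xd=0\,(M)|=|\exists y\,(x=yd\wedge yb=0)\,/\,x=0\,(M)|$; (iv) $|x=x\,/\,xd=0\,(M)|=|d\mid x\,/\,x=0\,(M)|$.
   Context: $c\mid x$ abbreviates $\exists y\,(yc=x)$ and $c\mid xa$ abbreviates $\exists y\,(yc=xa)$. For pp-formulas $\phi,\psi$ in one free variable and an $R$-module $M$, $|\phi/\psi(M)|$ denotes the index $[\phi(M):\phi(M)\cap\psi(M)]$ (finite or infinite), where $\phi(M)$ is the subgroup of $M$ defined by $\phi$. -}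

module Defs where

open import Level using (Level; _⊔_)
open import Data.Nat using (ℕ; zero; suc)
open import Data.Fin using (Fin; zero; suc)
open import Data.Product using (Σ; ∃; _×_; _,_)
open import Data.Sum using (_⊎_)
open import Relation.Nullary using (¬_)
open import Relation.Binary.PropositionalEquality using (_≡_)
open import Algebra.Bundles using (CommutativeRing)
open import Algebra.Module.Bundles using (Module)

private
  variable
    r ℓr m ℓm : Level

module _ (R : CommutativeRing r ℓr) where
  open CommutativeRing R using (Carrier; _≈_; _+_; _*_; 0#; 1#)

  ∑ : (n : ℕ) → (Fin n → Carrier) → Carrier
  ∑ zero    f = 0#
  ∑ (suc n) f = f zero + ∑ n (λ i → f (suc i))

  _∣R_ : Carrier → Carrier → Set (r ⊔ ℓr)
  c ∣R x = Σ Carrier λ y → y * c ≈ x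

  IsIntegralDomain : Set (r ⊔ ℓr)
  IsIntegralDomain =
    (¬ (1# ≈ 0#)) ×
    (∀ x y → x * y ≈ 0# → (x ≈ 0#) ⊎ (y ≈ 0#))

  -- The finitely generated ideal I = (a 0 , … , a (n-1)) is invertible
  -- (as a fractional ideal).  Clearing denominators, this says: there is a
  -- finitely generated ideal J = (b 0 , … , b (k-1)) and a nonzero c with
  -- I J = c R, i.e. every product a i * b j lies in c R and c lies in I J.
  IsInvertibleFG : (n : ℕ) → (Fin n → Carrier) → Set (r ⊔ ℓr)
  IsInvertibleFG n a =
    Σ ℕ λ k → Σ (Fin k → Carrier) λ b → Σ Carrier λ c →
      (¬ (c ≈ 0#)) ×
      (∀ i j → c ∣R (a i * b j)) ×
      (Σ (Fin n → Fin k → Carrier) λ t →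
         c ≈ ∑ n (λ i → ∑ k (λ j → t i j * (a i * b j))))

  IsPruferDomain : Set (r ⊔ ℓr)
  IsPruferDomain =
    IsIntegralDomain ×
    (∀ n (a : Fin n → Carrier) → (Σ (Fin n) λ i → ¬ (a i ≈ 0#)) →
       IsInvertibleFG n a)

module _ {R : CommutativeRing r ℓr} (M : Module R m ℓm) where
  open CommutativeRing R using () renaming (Carrier to R₀)
  open Module M

  Pred : Set _
  Pred = Carrierᴹ → Set (r ⊔ m ⊔ ℓm)

  ppTop : Pred
  ppTop x = Level.Lift (r ⊔ m) (x ≈ᴹ x)

  ppZero : Pred
  ppZero x = Level.Lift (r ⊔ m) (x ≈ᴹ 0ᴹ)

  ppDiv : R₀ → Pred
  ppDiv c x = Level.Lift (r ⊔ m) (Σ Carrierᴹ λ y → y *ᵣ c ≈ᴹ x)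

  ppDivMul : R₀ → R₀ → Pred
  ppDivMul c a x = Level.Lift (r ⊔ m) (Σ Carrierᴹ λ y → y *ᵣ c ≈ᴹ x *ᵣ a)

  ppAnn : R₀ → Pred
  ppAnn d x = Level.Lift (r ⊔ m) (x *ᵣ d ≈ᴹ 0ᴹ)

  ppMulAnn : R₀ → R₀ → Pred
  ppMulAnn d b x = Level.Lift (r ⊔ m) (Σ Carrierᴹ λ y → (x ≈ᴹ y *ᵣ d) × (y *ᵣ b ≈ᴹ 0ᴹ))

  -- The index [φ(M) : φ(M) ∩ ψ(M)] equals the natural number n:
  -- there are n elements of φ(M) forming a complete, irredundant system
  -- of coset representatives of φ(M) ∩ ψ(M) in φ(M).
  HasIndex : Pred → Pred → ℕ → Set _
  HasIndex φ ψ n =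
    Σ (Fin n → Σ Carrierᴹ φ) λ f →
      (∀ i j → let (u , _) = f i ; (v , _) = f j in
                 φ (u +ᴹ -ᴹ v) × ψ (u +ᴹ -ᴹ v) → i ≡ j) ×
      (∀ (x : Carrierᴹ) → φ x →
         Σ (Fin n) λ i → let (u , _) = f i in
           φ (x +ᴹ -ᴹ u) × ψ (x +ᴹ -ᴹ u))

  -- |φ/ψ(M)| = |φ'/ψ'(M)| as elements of ℕ ∪ {∞}: for every n, one index
  -- equals n iff the other does (so both are infinite or both equal n).
  SameIndex : Pred → Pred → Pred → Pred → Set _
  SameIndex φ ψ φ' ψ' =
    ∀ n → (HasIndex φ ψ n → HasIndex φ' ψ' n) × (HasIndex φ' ψ' n → HasIndex φ ψ n)

{-# OPTIONS --safe #-}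
module Submission where

-- Each index is the size of a quotient group, and in every case multiplication by a
-- scalar s is an additive map from the first numerator φ(M) onto the second one φ'(M)
-- under which ψ(M) ∩ φ(M) is exactly the preimage of ψ'(M).  Such a map induces an
-- isomorphism φ(M)/(φ ∩ ψ)(M) ≅ φ'(M)/(φ' ∩ ψ')(M), so coset representatives can be
-- pushed forward along it and pulled back through chosen preimages.

open import Defs
open import Level using (Level; _⊔_; lift)
open import Data.Product using (_×_; _,_; Σ; proj₁; proj₂; swap)
open import Data.Fin using (Fin)
open import Relation.Binary.Definitions using (_Respects_)
open import Relation.Binary.PropositionalEquality using (_≡_)
open import Algebra.Bundles using (CommutativeRing)
open import Algebra.Module.Bundles using (Module)

module _ {r ℓr m ℓm : Level} {R : CommutativeRing r ℓr} (M : Module R m ℓm) where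
  open CommutativeRing R using (_*_)
  open Module M
  open import Algebra.Module.Properties M using (inverseˡ-uniqueᴹ)

  infixl 6 _-_
  _-_ : Carrierᴹ → Carrierᴹ → Carrierᴹ
  u - v = u +ᴹ -ᴹ v

  SubtractionClosed : Pred M → Set (r ⊔ m ⊔ ℓm)
  SubtractionClosed P = ∀ {x y} → P x → P y → P (x - y)

  record IndexTransfer (φ ψ φ' ψ' : Pred M) : Set (r ⊔ m ⊔ ℓm) where
    field
      map        : Carrierᴹ → Carrierᴹ
      map-cong   : ∀ {x y} → x ≈ᴹ y → map x ≈ᴹ map y
      map-minus  : ∀ u v → map (u - v) ≈ᴹ map u - map v
      map-into   : ∀ {x} → φ x → φ' (map x)
      map-onto   : ∀ {y} → φ' y → Σ Carrierᴹ λ x → φ x × (map x ≈ᴹ y)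
      preserves  : ∀ {x} → φ x → ψ x → ψ' (map x)
      reflects   : ∀ {x} → φ x → ψ' (map x) → ψ x

  module _ {φ ψ φ' ψ' : Pred M}
           (φ-closed : SubtractionClosed φ) (φ'-closed : SubtractionClosed φ')
           (φ'-resp : φ' Respects _≈ᴹ_) (ψ'-resp : ψ' Respects _≈ᴹ_)
           (T : IndexTransfer φ ψ φ' ψ') where
    open IndexTransfer T

    pushIndex : ∀ {n} → HasIndex M φ ψ n → HasIndex M φ' ψ' n
    pushIndex (f , distinct , cover) = f' , distinct' , cover'
      where
      f' : Fin _ → Σ Carrierᴹ φ'
      f' i = map (proj₁ (f i)) , map-into (proj₂ (f i))

      distinct' : ∀ i j → φ' (map (proj₁ (f i)) - map (proj₁ (f j)))
                        × ψ' (map (proj₁ (f i)) - map (proj₁ (f j))) → i ≡ j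
      distinct' i j (_ , inψ') = distinct i j
        (φ-diff , reflects φ-diff (ψ'-resp (≈ᴹ-sym (map-minus _ _)) inψ'))
        where φ-diff = φ-closed (proj₂ (f i)) (proj₂ (f j))

      cover' : ∀ y → φ' y → Σ (Fin _) λ i → φ' (y - map (proj₁ (f i)))
                                           × ψ' (y - map (proj₁ (f i)))
      cover' y inφ' with map-onto inφ'
      ... | x , inφ , x↦y with cover x inφ
      ... | i , φ-diff , ψ-diff =
        i , φ'-resp diff↦ (map-into φ-diff) , ψ'-resp diff↦ (preserves φ-diff ψ-diff)
        where
        diff↦ : map (x - proj₁ (f i)) ≈ᴹ y - map (proj₁ (f i))
        diff↦ = ≈ᴹ-trans (map-minus _ _) (+ᴹ-congʳ x↦y)

    pullIndex : ∀ {n} → HasIndex M φ' ψ' n → HasIndex M φ ψ n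
    pullIndex (g , distinct , cover) = f , distinct' , cover'
      where
      preimage : ∀ i → Σ Carrierᴹ λ x → φ x × (map x ≈ᴹ proj₁ (g i))
      preimage i = map-onto (proj₂ (g i))

      rep : Fin _ → Carrierᴹ
      rep i = proj₁ (preimage i)

      rep↦ : ∀ i → map (rep i) ≈ᴹ proj₁ (g i)
      rep↦ i = proj₂ (proj₂ (preimage i))

      f : Fin _ → Σ Carrierᴹ φ
      f i = rep i , proj₁ (proj₂ (preimage i))

      distinct' : ∀ i j → φ (rep i - rep j) × ψ (rep i - rep j) → i ≡ j
      distinct' i j (φ-diff , ψ-diff) = distinct i j
        (φ'-closed (proj₂ (g i)) (proj₂ (g j)) , ψ'-resp diff↦ (preserves φ-diff ψ-diff))
        where
        diff↦ : map (rep i - rep j) ≈ᴹ proj₁ (g i) - proj₁ (g j)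
        diff↦ = ≈ᴹ-trans (map-minus _ _) (+ᴹ-cong (rep↦ i) (-ᴹ‿cong (rep↦ j)))

      cover' : ∀ x → φ x → Σ (Fin _) λ i → φ (x - rep i) × ψ (x - rep i)
      cover' x inφ with cover (map x) (map-into inφ)
      ... | i , _ , ψ'-diff = i , φ-diff , reflects φ-diff (ψ'-resp (≈ᴹ-sym diff↦) ψ'-diff)
        where
        φ-diff = φ-closed inφ (proj₂ (f i))
        diff↦ : map (x - rep i) ≈ᴹ map x - proj₁ (g i)
        diff↦ = ≈ᴹ-trans (map-minus _ _) (+ᴹ-congˡ (-ᴹ‿cong (rep↦ i)))

    IndexTransfer⇒SameIndex : SameIndex M φ ψ φ' ψ'
    IndexTransfer⇒SameIndex n = pushIndex , pullIndex

  *ᵣ-distribʳ-minus : ∀ s u v → (u - v) *ᵣ s ≈ᴹ u *ᵣ s - v *ᵣ s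
  *ᵣ-distribʳ-minus s u v = ≈ᴹ-trans (*ᵣ-distribʳ s u (-ᴹ v)) (+ᴹ-congˡ -ᴹ‿*ᵣ)
    where
    -ᴹ‿*ᵣ : (-ᴹ v) *ᵣ s ≈ᴹ -ᴹ (v *ᵣ s)
    -ᴹ‿*ᵣ = inverseˡ-uniqueᴹ _ _
      (≈ᴹ-trans (≈ᴹ-sym (*ᵣ-distribʳ s (-ᴹ v) v))
        (≈ᴹ-trans (*ᵣ-congʳ (-ᴹ‿inverseˡ v)) (*ᵣ-zeroˡ s)))

  ppTop-closed : SubtractionClosed (ppTop M)
  ppTop-closed _ _ = lift ≈ᴹ-refl

  ppDiv-closed : ∀ s → SubtractionClosed (ppDiv M s)
  ppDiv-closed s (lift (y , ys≈)) (lift (z , zs≈)) =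
    lift (y - z , ≈ᴹ-trans (*ᵣ-distribʳ-minus s y z) (+ᴹ-cong ys≈ (-ᴹ‿cong zs≈)))

  ppAnn-closed : ∀ s → SubtractionClosed (ppAnn M s)
  ppAnn-closed s (lift xs≈0) (lift ys≈0) = lift (≈ᴹ-trans (*ᵣ-distribʳ-minus s _ _)
    (≈ᴹ-trans (+ᴹ-cong xs≈0 (-ᴹ‿cong ys≈0)) (-ᴹ‿inverseʳ 0ᴹ)))

  ppMulAnn-closed : ∀ d b → SubtractionClosed (ppMulAnn M d b)
  ppMulAnn-closed d b (lift (y , x≈yd , yb≈0)) (lift (z , x'≈zd , zb≈0)) =
    lift (y - z
         , ≈ᴹ-trans (+ᴹ-cong x≈yd (-ᴹ‿cong x'≈zd)) (≈ᴹ-sym (*ᵣ-distribʳ-minus d y z))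
         , ≈ᴹ-trans (*ᵣ-distribʳ-minus b y z)
             (≈ᴹ-trans (+ᴹ-cong yb≈0 (-ᴹ‿cong zb≈0)) (-ᴹ‿inverseʳ 0ᴹ)))

  ppZero-resp : ppZero M Respects _≈ᴹ_
  ppZero-resp x≈y (lift x≈0) = lift (≈ᴹ-trans (≈ᴹ-sym x≈y) x≈0)

  ppDiv-resp : ∀ s → ppDiv M s Respects _≈ᴹ_
  ppDiv-resp s x≈y (lift (z , zs≈x)) = lift (z , ≈ᴹ-trans zs≈x x≈y)

  ppAnn-resp : ∀ s → ppAnn M s Respects _≈ᴹ_
  ppAnn-resp s x≈y (lift xs≈0) = lift (≈ᴹ-trans (*ᵣ-congʳ (≈ᴹ-sym x≈y)) xs≈0)

  ppMulAnn-resp : ∀ d b → ppMulAnn M d b Respects _≈ᴹ_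
  ppMulAnn-resp d b x≈y (lift (z , x≈zd , zb≈0)) = lift (z , ≈ᴹ-trans (≈ᴹ-sym x≈y) x≈zd , zb≈0)

  scaling : ∀ s {φ ψ φ' ψ'} →
    (∀ {x} → φ x → φ' (x *ᵣ s)) →
    (∀ {y} → φ' y → Σ Carrierᴹ λ x → φ x × (x *ᵣ s ≈ᴹ y)) →
    (∀ {x} → φ x → ψ x → ψ' (x *ᵣ s)) →
    (∀ {x} → φ x → ψ' (x *ᵣ s) → ψ x) →
    IndexTransfer φ ψ φ' ψ'
  scaling s into onto preserves reflects = record
    { map = _*ᵣ s ; map-cong = *ᵣ-congʳ ; map-minus = *ᵣ-distribʳ-minus s
    ; map-into = into ; map-onto = onto ; preserves = preserves ; reflects = reflects }

  sameIndex-top-div : ∀ s (ψ ψ' : Pred M) → ψ' Respects _≈ᴹ_ →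
    (∀ {x} → ψ x → ψ' (x *ᵣ s)) → (∀ {x} → ψ' (x *ᵣ s) → ψ x) →
    SameIndex M (ppTop M) ψ (ppDiv M s) ψ'
  sameIndex-top-div s ψ ψ' ψ'-resp preserves reflects =
    IndexTransfer⇒SameIndex ppTop-closed (ppDiv-closed s) (ppDiv-resp s) ψ'-resp
      (scaling s (λ {x} _ → lift (x , ≈ᴹ-refl)) (λ (lift (x , xs≈y)) → x , lift ≈ᴹ-refl , xs≈y)
         (λ _ → preserves) (λ _ → reflects))

  sameIndex-div-div : ∀ a c → SameIndex M (ppDiv M a) (ppDiv M c) (ppTop M) (ppDivMul M c a)
  sameIndex-div-div a c n = swap (sameIndex-top-div a (ppDivMul M c a) (ppDiv M c) (ppDiv-resp c)
    (λ (lift div) → lift div) (λ (lift div) → lift div) n)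

  sameIndex-div-ann : ∀ a d → SameIndex M (ppDiv M a) (ppAnn M d) (ppTop M) (ppAnn M (a * d))
  sameIndex-div-ann a d n = swap (sameIndex-top-div a (ppAnn M (a * d)) (ppAnn M d) (ppAnn-resp d)
    (λ {x} (lift x[ad]≈0) → lift (≈ᴹ-trans (*ᵣ-assoc x a d) x[ad]≈0))
    (λ {x} (lift [xa]d≈0) → lift (≈ᴹ-trans (≈ᴹ-sym (*ᵣ-assoc x a d)) [xa]d≈0)) n)

  sameIndex-top-ann : ∀ d → SameIndex M (ppTop M) (ppAnn M d) (ppDiv M d) (ppZero M)
  sameIndex-top-ann d = sameIndex-top-div d (ppAnn M d) (ppZero M) ppZero-resp
    (λ (lift xd≈0) → lift xd≈0) (λ (lift xd≈0) → lift xd≈0)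

  sameIndex-ann-ann : ∀ b d → SameIndex M (ppAnn M b) (ppAnn M d) (ppMulAnn M d b) (ppZero M)
  sameIndex-ann-ann b d =
    IndexTransfer⇒SameIndex (ppAnn-closed b) (ppMulAnn-closed d b) (ppMulAnn-resp d b) ppZero-resp
      (scaling d (λ {x} (lift xb≈0) → lift (x , ≈ᴹ-refl , xb≈0))
                 (λ (lift (x , y≈xd , xb≈0)) → x , lift xb≈0 , ≈ᴹ-sym y≈xd)
                 (λ _ (lift xd≈0) → lift xd≈0) (λ _ (lift xd≈0) → lift xd≈0))

lemma4p3 : ∀ {r ℓr m ℓm : Level} (R : CommutativeRing r ℓr) → IsPruferDomain R →
    (M : Module R m ℓm) → (a b c d : CommutativeRing.Carrier R) →
    SameIndex M (ppDiv M a) (ppDiv M c) (ppTop M) (ppDivMul M c a)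
    × SameIndex M (ppDiv M a) (ppAnn M d) (ppTop M) (ppAnn M (CommutativeRing._*_ R a d))
    × SameIndex M (ppAnn M b) (ppAnn M d) (ppMulAnn M d b) (ppZero M)
    × SameIndex M (ppTop M) (ppAnn M d) (ppDiv M d) (ppZero M)
lemma4p3 R _ M a b c d =
  sameIndex-div-div M a c , sameIndex-div-ann M a d , sameIndex-ann-ann M b d , sameIndex-top-ann M d
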